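{- Let $n\ge1$ and let $\lambda=(\lambda_1,\ldots,\lambda_n)$ be a partition of $n(n-1)$ with $n-1\le\ell(\lambda)\le n$ (so $\lambda_n$ may be $0$) and $\langle a_{\delta_n}^2,s_\lambda\rangle\ne0$. If $\lambda_n=\lambda_{n-1}=\cdots=\lambda_{n-i}=s$ for some $i\ge 0$ and integer $s$, then $i\le s$; that is, at most $s+1$ of the bottom rows of $\lambda$ have size $s$.
   Context: $\ell(\lambda)$ is the number of nonzero parts of $\lambda$. $a_{\delta_n}=\prod_{1\le i<j\le n}(x_i-x_j)$ is the Vandermonde determinant in $x_1,\ldots,x_n$. For a symmetric polynomial $f$ in $x_1,\ldots,x_n$ and a partition $\lambda$ with at most $n$ parts, $\langle f,s_\lambda\rangle$ denotes the coefficient of the Schur polynomial $s_\lambda(x_1,\ldots,x_n)$ in the expansion of $f$ in the Schur basis. -}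

module Defs where

open import Data.Nat as ℕ using (ℕ; zero; suc; _≤_; _<_; _∸_)
open import Data.Integer as ℤ using (ℤ; +_; -[1+_])
open import Data.Fin using (Fin; toℕ)
open import Data.Fin.Base as Fin using ()
open import Data.Vec as Vec using (Vec; []; _∷_; _∷ʳ_; lookup; replicate; updateAt; zipWith)
open import Data.Vec.Properties using (≡-dec)
open import Data.List as List using (List; []; _∷_; _++_; concatMap; map; filter; foldr; upTo; allFin)
open import Data.Product using (_×_; _,_; proj₁; proj₂)
open import Data.Bool using (Bool; true; false; _∧_; if_then_else_)
open import Relation.Nullary.Decidable using (does)

-- Polynomials in n variables x_1..x_n over ℤ, as formal finite sums of
-- monomials c·x^e (e : Vec ℕ n the exponent vector).  Two polynomials are
-- equal iff all their coefficients agree (PolyEq).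

Poly : ℕ → Set
Poly n = List (ℤ × Vec ℕ n)

coeff : ∀ {n} → Poly n → Vec ℕ n → ℤ
coeff p e = List.foldr (λ t acc → (if does (≡-dec ℕ._≟_ (proj₂ t) e) then proj₁ t else + 0) ℤ.+ acc) (+ 0) p

PolyEq : ∀ {n} → Poly n → Poly n → Set
PolyEq {n} p q = (e : Vec ℕ n) → coeff p e ≡′ coeff q e
  where open import Relation.Binary.PropositionalEquality renaming (_≡_ to _≡′_)

pone : ∀ {n} → Poly n
pone {n} = (+ 1 , replicate n 0) ∷ []

padd : ∀ {n} → Poly n → Poly n → Poly n
padd p q = p ++ q

pscale : ∀ {n} → ℤ → Poly n → Poly n
pscale c p = map (λ t → (c ℤ.* proj₁ t , proj₂ t)) p

pmul : ∀ {n} → Poly n → Poly n → Poly n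
pmul p q = concatMap (λ s → map (λ t → (proj₁ s ℤ.* proj₁ t , zipWith ℕ._+_ (proj₂ s) (proj₂ t))) q) p

pprod : ∀ {n} → List (Poly n) → Poly n
pprod = foldr pmul pone

psum : ∀ {n} → List (Poly n) → Poly n
psum = foldr padd []

var : ∀ {n} → Fin n → Poly n
var {n} i = (+ 1 , updateAt (replicate n 0) i (λ _ → 1)) ∷ []

vandermonde : (n : ℕ) → Poly n
vandermonde n = pprod (concatMap (λ i → concatMap (λ j →
    if does (toℕ i ℕ.<? toℕ j) then padd (var i) (pscale (ℤ.- (+ 1)) (var j)) ∷ [] else []) (allFin n)) (allFin n))

-- Schur polynomials s_μ(x_1..x_n), defined as the generating function of
-- semistandard Young tableaux of shape μ with entries in {1..n}, encoded as
-- Gelfand–Tsetlin patterns: a tableau with entries ≤ n+1 and shape μ is a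
-- tableau with entries ≤ n of a shape ν interlacing μ
-- (μ_1 ≥ ν_1 ≥ μ_2 ≥ … ≥ ν_n ≥ μ_{n+1}), plus the horizontal strip μ/ν
-- filled with n+1, contributing x_{n+1}^{|μ|-|ν|}.

range : ℕ → ℕ → List ℕ   -- [a, b]
range a b = map (a ℕ.+_) (upTo (suc (b ∸ a)))

interlacing : ∀ {n} → Vec ℕ (suc n) → List (Vec ℕ n)
interlacing (a ∷ []) = [] ∷ []
interlacing (a ∷ b ∷ rest) = concatMap (λ v → map (v ∷_) (interlacing (b ∷ rest))) (range b a)

vsum : ∀ {n} → Vec ℕ n → ℕ
vsum = Vec.foldr _ ℕ._+_ 0

extendBy : ∀ {n} → ℕ → Poly n → Poly (suc n)
extendBy k p = map (λ t → (proj₁ t , proj₂ t ∷ʳ k)) p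

schur : (n : ℕ) → Vec ℕ n → Poly n
schur zero [] = pone
schur (suc n) μ = psum (map (λ ν → extendBy (vsum μ ∸ vsum ν) (schur n ν)) (interlacing μ))

-- Partitions with at most n parts, as weakly decreasing vectors of length n.

isDecreasingB : ∀ {n} → Vec ℕ n → Bool
isDecreasingB [] = true
isDecreasingB (a ∷ []) = true
isDecreasingB (a ∷ b ∷ rest) = does (b ℕ.≤? a) ∧ isDecreasingB (b ∷ rest)

IsPartition : ∀ {n} → Vec ℕ n → Set
IsPartition {n} λ′ = ∀ (i j : Fin n) → toℕ i ≤ toℕ j → lookup λ′ j ≤ lookup λ′ i

allVecs : (n bound : ℕ) → List (Vec ℕ n)
allVecs zero b = [] ∷ []
allVecs (suc n) b = concatMap (λ a → map (a ∷_) (allVecs n b)) (upTo (suc b))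

partitionsOf : (n N : ℕ) → List (Vec ℕ n)
partitionsOf n N = List.filterᵇ (λ v → does (vsum v ℕ.≟ N) ∧ isDecreasingB v) (allVecs n N)

len : ∀ {n} → Vec ℕ n → ℕ
len [] = 0
len (zero ∷ v) = len v
len (suc _ ∷ v) = suc (len v)

-- ⟨f, s_λ⟩ ≠ 0 for f homogeneous of degree N: in the (unique) expansion
-- f = Σ_{μ ⊢ N, ℓ(μ) ≤ n} c_μ s_μ(x_1..x_n), the coefficient c_λ is nonzero.
SchurCoeffNonzero : (n N : ℕ) → Poly n → Vec ℕ n → Set
SchurCoeffNonzero n N f λ′ =
  Σ (Vec ℕ n → ℤ) λ c →
    PolyEq f (psum (map (λ μ → pscale (c μ) (schur n μ)) (partitionsOf n N)))
    × (c λ′ ≢ + 0)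
  where open import Data.Product using (Σ)
        open import Relation.Binary.PropositionalEquality using (_≢_)

module Submission where

-- Proof idea.  Put N = n(n-1), m = n-(i+1), and for an exponent vector e
-- write pre m e = e₁ + … + e_m.
--
-- (1) A factor x_a - x_b (a < b) of a_δ contributes at most 1 to the first m
--     exponents, and only if a < m.  Hence every monomial x^e of a_δ² has
--     pre m e ≤ B := 2·T, where T counts the pairs a < b < n with a < m;
--     counting gives B + (i+1)·i = N.
-- (2) If the last i+1 parts of λ equal s and s < i, then
--     pre m λ = N - (i+1)·s > N - (i+1)·i = B.
-- (3) Schur expansions are unitriangular for the dominance order: s_ν only
--     has monomials x^e with e ⊴ ν, and x^ν with a positive coefficient.
--     So if f = Σ c_ν s_ν and no monomial of f lies in a dominance-upward-closed
--     set U, then c_ν = 0 for all ν ∈ U: otherwise take such ν with c_ν ≠ 0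
--     maximising Σ_p pre p ν, and x^ν occurs in Σ c_ν s_ν but not in f.
-- Applying (3) to f = a_δ² and U = {e | B < pre m e} gives c_λ = 0 by (1), (2).

open import Defs
open import Data.Nat as ℕ using (ℕ; zero; suc; _≤_; _<_; _*_; _∸_; _+_; _⊔_; z≤n; s≤s)
import Data.Nat.Properties as ℕP
open import Data.Nat.ListAction using (sum)
open import Data.Nat.ListAction.Properties using (sum-++)
open import Data.Nat.Solver using (module +-*-Solver)
open import Data.Integer as ℤ using (ℤ; +_)
import Data.Integer.Properties as ℤP
open import Data.Fin using (Fin; toℕ; zero; suc)
open import Data.Vec as Vec using (Vec; []; _∷_; lookup; _∷ʳ_; replicate; updateAt; zipWith)
open import Data.Vec.Properties using (≡-dec)
open import Data.List as List using (List; []; _∷_; _++_; map; concatMap; tabulate; allFin; filter)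
open import Data.List.Properties using (map-++)
open import Data.List.Relation.Unary.All as All using (All; []; _∷_)
import Data.List.Relation.Unary.All.Properties as AllP
open import Data.List.Relation.Unary.Any as Any using (Any; here; there)
import Data.List.Relation.Unary.Any.Properties as AnyP
open import Data.List.Membership.Propositional using (_∈_; find; lose)
open import Data.List.Membership.Propositional.Properties
  using (∈-map⁺; ∈-map⁻; ∈-concatMap⁺; ∈-concatMap⁻; ∈-filter⁺; ∈-filter⁻; ∈-upTo⁺; ∈-upTo⁻)
open import Data.List.Extrema.Nat using (argmax; argmax-all; f[xs]≤f[argmax])
open import Data.Bool using (true; false; T; _∧_; if_then_else_)
open import Data.Bool.Properties using (T-∧)
open import Data.Product using (Σ; _×_; _,_; proj₁; proj₂)
open import Data.Sum as Sum using (_⊎_; inj₁; inj₂; [_,_]′)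
open import Data.Unit using (⊤; tt)
open import Data.Empty using (⊥-elim)
open import Function using (_∘_; id)
open import Function.Bundles using (Equivalence)
open import Relation.Nullary using (¬_; Dec; yes; no; does; ofʸ; ofⁿ)
open import Relation.Nullary.Decidable using (_×-dec_; ¬?; T?)
open import Relation.Unary using (Decidable)
open import Relation.Binary.PropositionalEquality
open import Algebra.Properties.CommutativeSemigroup ℕP.+-commutativeSemigroup using (interchange)

Supp : ∀ {n} → (Vec ℕ n → Set) → Poly n → Set
Supp P p = All (λ t → P (proj₂ t)) p

termCoeff : ∀ {n} → ℤ × Vec ℕ n → Vec ℕ n → ℤ
termCoeff t e = if does (≡-dec ℕ._≟_ (proj₂ t) e) then proj₁ t else + 0

coeff-++ : ∀ {n} (p q : Poly n) e → coeff (p ++ q) e ≡ coeff p e ℤ.+ coeff q e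
coeff-++ [] q e = sym (ℤP.+-identityˡ _)
coeff-++ (t ∷ p) q e =
  trans (cong (ℤ._+_ (termCoeff t e)) (coeff-++ p q e))
        (sym (ℤP.+-assoc (termCoeff t e) (coeff p e) (coeff q e)))

coeff-scale : ∀ {n} c (p : Poly n) e → coeff (pscale c p) e ≡ c ℤ.* coeff p e
coeff-scale c [] e = sym (ℤP.*-zeroʳ c)
coeff-scale c (t ∷ p) e with ≡-dec ℕ._≟_ (proj₂ t) e
... | yes _ = trans (cong (ℤ._+_ (c ℤ.* proj₁ t)) (coeff-scale c p e))
                    (sym (ℤP.*-distribˡ-+ c (proj₁ t) (coeff p e)))
... | no _  = trans (ℤP.+-identityˡ _)
                    (trans (coeff-scale c p e) (cong (c ℤ.*_) (sym (ℤP.+-identityˡ _))))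

coeff-outside : ∀ {n} {P : Vec ℕ n → Set} (p : Poly n) {e} → Supp P p → ¬ P e → coeff p e ≡ + 0
coeff-outside [] _ _ = refl
coeff-outside (t ∷ p) {e} (Pt ∷ Pp) ¬Pe with ≡-dec ℕ._≟_ (proj₂ t) e
... | yes refl = ⊥-elim (¬Pe Pt)
... | no _     = trans (ℤP.+-identityˡ _) (coeff-outside p Pp ¬Pe)

coeff-inside : ∀ {n} {P : Vec ℕ n → Set} (p : Poly n) {e} → Supp P p → coeff p e ≢ + 0 → P e
coeff-inside [] [] nonzero = ⊥-elim (nonzero refl)
coeff-inside (t ∷ p) {e} (Pt ∷ Pp) nonzero with ≡-dec ℕ._≟_ (proj₂ t) e
... | yes refl = Pt
... | no _     = coeff-inside p Pp (nonzero ∘ trans (ℤP.+-identityˡ _))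

UnitCoeffs : ∀ {n} → Poly n → Set
UnitCoeffs p = All (λ t → proj₁ t ≡ + 1) p

coeff-count : ∀ {n} (p : Poly n) e → UnitCoeffs p → Σ ℕ λ k → coeff p e ≡ + k
coeff-count [] e [] = 0 , refl
coeff-count ((_ , e′) ∷ p) e (refl ∷ ones) with coeff-count p e ones | ≡-dec ℕ._≟_ e′ e
... | k , eq | yes _ = suc k , cong (ℤ._+_ (+ 1)) eq
... | k , eq | no _  = k , trans (ℤP.+-identityˡ _) eq

coeff-occurs : ∀ {n} (p : Poly n) e → UnitCoeffs p → Any (λ t → proj₂ t ≡ e) p →
               Σ ℕ λ k → coeff p e ≡ + suc k
coeff-occurs ((_ , e′) ∷ p) e (refl ∷ ones) (here refl) with coeff-count p e ones | ≡-dec ℕ._≟_ e′ e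
... | k , eq | yes _   = k , cong (ℤ._+_ (+ 1)) eq
... | _      | no e≢e  = ⊥-elim (e≢e refl)
coeff-occurs ((_ , e′) ∷ p) e (refl ∷ ones) (there occ) with coeff-occurs p e ones occ | ≡-dec ℕ._≟_ e′ e
... | k , eq | yes _ = suc k , cong (ℤ._+_ (+ 1)) eq
... | k , eq | no _  = k , trans (ℤP.+-identityˡ _) eq

all-psum : ∀ {n} {A : Set} {P : ℤ × Vec ℕ n → Set} (g : A → Poly n) (L : List A) →
           (∀ {x} → x ∈ L → All P (g x)) → All P (psum (map g L))
all-psum g L each = AllP.concat⁺ (AllP.map⁺ (All.tabulate each))

any-psum : ∀ {n} {A : Set} {P : ℤ × Vec ℕ n → Set} (g : A → Poly n) {L : List A} {x} →
           x ∈ L → Any P (g x) → Any P (psum (map g L))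
any-psum g x∈L found = AnyP.concat⁺ (AnyP.map⁺ (lose x∈L found))

module _ {n} {A : Set} (g : A → Poly n) (e : Vec ℕ n) (X : ℤ) where

  ZeroOrX : A → Set
  ZeroOrX x = coeff (g x) e ≡ + 0 ⊎ coeff (g x) e ≡ X

  private
    add-zero : ∀ {a b k} → a ≡ + 0 → b ≡ + k ℤ.* X → a ℤ.+ b ≡ + k ℤ.* X
    add-zero refl b≡ = trans (ℤP.+-identityˡ _) b≡

    add-X : ∀ {a b k} → a ≡ X → b ≡ + k ℤ.* X → a ℤ.+ b ≡ + suc k ℤ.* X
    add-X {k = k} refl refl = sym (ℤP.suc-* (+ k) X)

  coeff-sum-uniform : ∀ (L : List A) → (∀ {x} → x ∈ L → ZeroOrX x) →
                      Σ ℕ λ k → coeff (psum (map g L)) e ≡ + k ℤ.* X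
  coeff-sum-uniform [] _ = 0 , sym (ℤP.*-zeroˡ X)
  coeff-sum-uniform (x ∷ L) each with coeff-sum-uniform L (each ∘ there) | each (here refl)
  ... | k , eq | inj₁ gx≡0 = k     , trans (coeff-++ (g x) _ e) (add-zero {k = k} gx≡0 eq)
  ... | k , eq | inj₂ gx≡X = suc k , trans (coeff-++ (g x) _ e) (add-X {k = k} gx≡X eq)

  coeff-sum-uniform⁺ : ∀ (L : List A) → (∀ {x} → x ∈ L → ZeroOrX x) →
                       ∀ {y} → y ∈ L → coeff (g y) e ≡ X →
                       Σ ℕ λ k → coeff (psum (map g L)) e ≡ + suc k ℤ.* X
  coeff-sum-uniform⁺ (x ∷ L) each (here refl) gx≡X
    with coeff-sum-uniform L (each ∘ there)
  ... | k , eq = k , trans (coeff-++ (g x) _ e) (add-X {k = k} gx≡X eq)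
  coeff-sum-uniform⁺ (x ∷ L) each (there y∈L) gy≡X
    with coeff-sum-uniform⁺ L (each ∘ there) y∈L gy≡X | each (here refl)
  ... | k , eq | inj₁ gx≡0 = k     , trans (coeff-++ (g x) _ e) (add-zero {k = suc k} gx≡0 eq)
  ... | k , eq | inj₂ gx≡X = suc k , trans (coeff-++ (g x) _ e) (add-X {k = suc k} gx≡X eq)

*-≢0 : ∀ {i j : ℤ} → i ≢ + 0 → j ≢ + 0 → i ℤ.* j ≢ + 0
*-≢0 {i} i≢0 j≢0 ij≡0 = [ i≢0 , j≢0 ]′ (ℤP.i*j≡0⇒i≡0∨j≡0 i ij≡0)

sumBelow : ℕ → (ℕ → ℕ) → ℕ
sumBelow zero    f = 0
sumBelow (suc k) f = f 0 + sumBelow k (λ p → f (suc p))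

sumBelow-mono : ∀ k {f g : ℕ → ℕ} → (∀ p → f p ≤ g p) → sumBelow k f ≤ sumBelow k g
sumBelow-mono zero    _   = z≤n
sumBelow-mono (suc k) f≤g = ℕP.+-mono-≤ (f≤g 0) (sumBelow-mono k (f≤g ∘ suc))

+-tight : ∀ {a b c d} → a ≤ c → b ≤ d → a + b ≡ c + d → a ≡ c × b ≡ d
+-tight {a} {b} {c} {d} a≤c b≤d eq = a≡c , ℕP.+-cancelˡ-≡ c b d (trans (cong (_+ b) (sym a≡c)) eq)
  where
  a≡c : a ≡ c
  a≡c = ℕP.≤-antisym a≤c
          (ℕP.+-cancelʳ-≤ b c a (subst (c + b ≤_) (sym eq) (ℕP.+-monoʳ-≤ c b≤d)))

sumBelow-tight : ∀ k {f g : ℕ → ℕ} → (∀ p → f p ≤ g p) → sumBelow k f ≡ sumBelow k g →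
                 ∀ {p} → p < k → f p ≡ g p
sumBelow-tight (suc k) f≤g eq {zero} _ =
  proj₁ (+-tight (f≤g 0) (sumBelow-mono k (f≤g ∘ suc)) eq)
sumBelow-tight (suc k) f≤g eq {suc p} (s≤s p<k) =
  sumBelow-tight k (f≤g ∘ suc) (proj₂ (+-tight (f≤g 0) (sumBelow-mono k (f≤g ∘ suc)) eq)) p<k

pre : ∀ {n} → ℕ → Vec ℕ n → ℕ
pre zero    _       = 0
pre (suc p) []      = 0
pre (suc p) (x ∷ v) = x + pre p v

-- Dominance, comparing all partial sums; lengths may differ (for interlacing).
_⊴_ : ∀ {n k} → Vec ℕ n → Vec ℕ k → Set
e ⊴ μ = ∀ p → pre p e ≤ pre p μ

Decreasing : ∀ {n} → Vec ℕ n → Set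
Decreasing []          = ⊤
Decreasing (a ∷ [])    = ⊤
Decreasing (a ∷ b ∷ v) = b ≤ a × Decreasing (b ∷ v)

pre-injective : ∀ {n} (v w : Vec ℕ n) → (∀ {p} → p ≤ n → pre p v ≡ pre p w) → v ≡ w
pre-injective [] [] _ = refl
pre-injective (x ∷ v) (y ∷ w) same = cong₂ _∷_ x≡y (pre-injective v w tails)
  where
  x≡y : x ≡ y
  x≡y = trans (sym (ℕP.+-identityʳ x)) (trans (same (s≤s z≤n)) (ℕP.+-identityʳ y))
  tails : ∀ {p} → p ≤ _ → pre p v ≡ pre p w
  tails {p} p≤n = ℕP.+-cancelˡ-≡ x _ _ (trans (same (s≤s p≤n)) (cong (_+ pre p w) (sym x≡y)))

-- Σ_{p ≤ n} pre p v; it strictly increases along strict dominance.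
potential : ∀ {n} → Vec ℕ n → ℕ
potential {n} v = sumBelow (suc n) (λ p → pre p v)

⊴-antisym : ∀ {n} {e ν : Vec ℕ n} → e ⊴ ν → potential ν ≤ potential e → e ≡ ν
⊴-antisym {n} {e} {ν} e⊴ν pot = pre-injective e ν λ p≤n →
  sumBelow-tight (suc n) e⊴ν (ℕP.≤-antisym (sumBelow-mono (suc n) e⊴ν) pot) (s≤s p≤n)

vsum-snoc : ∀ {n} (e : Vec ℕ n) d → vsum (e ∷ʳ d) ≡ vsum e + d
vsum-snoc []      d = ℕP.+-identityʳ d
vsum-snoc (x ∷ e) d = trans (cong (_+_ x) (vsum-snoc e d)) (sym (ℕP.+-assoc x (vsum e) d))

pre-snoc : ∀ {n} (e : Vec ℕ n) d p → p ≤ n → pre p (e ∷ʳ d) ≡ pre p e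
pre-snoc e       d zero    _         = refl
pre-snoc (x ∷ e) d (suc p) (s≤s p≤n) = cong (_+_ x) (pre-snoc e d p p≤n)

pre-full : ∀ {n} (v : Vec ℕ n) p → n ≤ p → pre p v ≡ vsum v
pre-full []      zero    _         = refl
pre-full []      (suc p) _         = refl
pre-full (x ∷ v) (suc p) (s≤s n≤p) = cong (_+_ x) (pre-full v p n≤p)

-- Support of Schur polynomials

range-bounds : ∀ {a b v} → b ≤ a → v ∈ range b a → b ≤ v × v ≤ a
range-bounds {a} {b} b≤a v∈ with ∈-map⁻ (_+_ b) v∈
... | t , t∈ , refl = ℕP.m≤m+n b t
                    , subst (b + t ≤_) (ℕP.m+[n∸m]≡n b≤a)
                            (ℕP.+-monoʳ-≤ b (ℕP.≤-pred (∈-upTo⁻ t∈)))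

range-top : ∀ {a b} → b ≤ a → a ∈ range b a
range-top {a} {b} b≤a =
  subst (_∈ range b a) (ℕP.m+[n∸m]≡n b≤a) (∈-map⁺ (_+_ b) (∈-upTo⁺ (s≤s ℕP.≤-refl)))

interlacing-⊴ : ∀ {n} (μ : Vec ℕ (suc n)) {ν} → Decreasing μ → ν ∈ interlacing μ →
                Decreasing ν × ν ⊴ μ
interlacing-⊴ (a ∷ []) _ (here refl) = tt , λ { zero → z≤n ; (suc p) → z≤n }
interlacing-⊴ (a ∷ b ∷ rest) (b≤a , rest-dec) ν∈
  with find (∈-concatMap⁻ (λ v → map (v ∷_) (interlacing (b ∷ rest))) ν∈)
... | v , v∈ , ν∈′ with ∈-map⁻ (v ∷_) ν∈′ | range-bounds b≤a v∈
... | ν′ , ν′∈ , refl | b≤v , v≤a with interlacing-⊴ (b ∷ rest) rest-dec ν′∈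
... | ν′-dec , ν′⊴ = cons-decreasing ν′ ν′-dec (ν′⊴ 1) , cons-⊴
  where
  cons-decreasing : ∀ {k} (w : Vec ℕ k) → Decreasing w → pre 1 w ≤ pre 1 (b ∷ rest) →
                    Decreasing (v ∷ w)
  cons-decreasing []      _     _   = tt
  cons-decreasing (x ∷ w) w-dec x≤b =
    ℕP.≤-trans (subst₂ _≤_ (ℕP.+-identityʳ x) (ℕP.+-identityʳ b) x≤b) b≤v , w-dec
  cons-⊴ : (v ∷ ν′) ⊴ (a ∷ b ∷ rest)
  cons-⊴ zero    = z≤n
  cons-⊴ (suc p) = ℕP.+-mono-≤ v≤a (ν′⊴ p)

interlacing-init : ∀ {n} (μ : Vec ℕ (suc n)) → Decreasing μ →
                   Σ (Vec ℕ n) λ ν → ν ∈ interlacing μ × ν ∷ʳ Vec.last μ ≡ μ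
interlacing-init (a ∷ []) _ = [] , here refl , refl
interlacing-init (a ∷ b ∷ rest) (b≤a , rest-dec) with interlacing-init (b ∷ rest) rest-dec
... | ν , ν∈ , ν≡ =
  a ∷ ν
  , ∈-concatMap⁺ (λ v → map (v ∷_) (interlacing (b ∷ rest)))
      (lose (range-top b≤a) (∈-map⁺ (a ∷_) ν∈))
  , cong (a ∷_) ν≡

SchurTerm : ∀ {n} → Vec ℕ n → ℤ × Vec ℕ n → Set
SchurTerm μ t = proj₁ t ≡ + 1 × proj₂ t ⊴ μ × vsum (proj₂ t) ≡ vsum μ

extend-term : ∀ {n} {μ : Vec ℕ (suc n)} {ν : Vec ℕ n} → ν ⊴ μ →
              ∀ {t} → SchurTerm ν t → SchurTerm μ (proj₁ t , proj₂ t ∷ʳ (vsum μ ∸ vsum ν))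
extend-term {n} {μ} {ν} ν⊴μ {c , e} (c≡1 , e⊴ν , |e|) = c≡1 , e′⊴μ , |e′|
  where
  d = vsum μ ∸ vsum ν
  |ν|≤|μ| : vsum ν ≤ vsum μ
  |ν|≤|μ| = subst₂ _≤_ (pre-full ν (suc n) (ℕP.n≤1+n n)) (pre-full μ (suc n) ℕP.≤-refl) (ν⊴μ (suc n))
  |e′| : vsum (e ∷ʳ d) ≡ vsum μ
  |e′| = trans (vsum-snoc e d) (trans (cong (_+ d) |e|) (ℕP.m+[n∸m]≡n |ν|≤|μ|))
  e′⊴μ : (e ∷ʳ d) ⊴ μ
  e′⊴μ p with p ℕ.≤? n
  ... | yes p≤n = subst (_≤ pre p μ) (sym (pre-snoc e d p p≤n)) (ℕP.≤-trans (e⊴ν p) (ν⊴μ p))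
  ... | no  p≰n = ℕP.≤-reflexive (trans (pre-full (e ∷ʳ d) p (ℕP.≰⇒> p≰n))
                                   (trans |e′| (sym (pre-full μ p (ℕP.≰⇒> p≰n)))))

schur-terms : ∀ n (μ : Vec ℕ n) → Decreasing μ → All (SchurTerm μ) (schur n μ)
schur-terms zero    [] _     = (refl , (λ { zero → z≤n ; (suc p) → z≤n }) , refl) ∷ []
schur-terms (suc n) μ  μ-dec = all-psum _ (interlacing μ) extended
  where
  extended : ∀ {ν} → ν ∈ interlacing μ → All (SchurTerm μ) (extendBy (vsum μ ∸ vsum ν) (schur n ν))
  extended ν∈ with interlacing-⊴ μ μ-dec ν∈
  ... | ν-dec , ν⊴μ = AllP.map⁺ (All.map (extend-term ν⊴μ) (schur-terms n _ ν-dec))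

schur-dominated : ∀ {n} {ν : Vec ℕ n} → Decreasing ν → Supp (_⊴ ν) (schur n ν)
schur-dominated ν-dec = All.map (proj₁ ∘ proj₂) (schur-terms _ _ ν-dec)

schur-unit : ∀ {n} {ν : Vec ℕ n} → Decreasing ν → UnitCoeffs (schur n ν)
schur-unit ν-dec = All.map proj₁ (schur-terms _ _ ν-dec)

schur-leading : ∀ n (μ : Vec ℕ n) → Decreasing μ → Any (λ t → proj₂ t ≡ μ) (schur n μ)
schur-leading zero    [] _ = here refl
schur-leading (suc n) μ  μ-dec with interlacing-init μ μ-dec
... | ν , ν∈ , ν≡ =
  any-psum (λ ν → extendBy (vsum μ ∸ vsum ν) (schur n ν)) ν∈
    (AnyP.map⁺ (Any.map (λ e≡ν → trans (cong₂ _∷ʳ_ e≡ν last≡) ν≡)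
      (schur-leading n ν (proj₁ (interlacing-⊴ μ μ-dec ν∈)))))
  where
  last≡ : vsum μ ∸ vsum ν ≡ Vec.last μ
  last≡ = trans (cong (λ w → vsum w ∸ vsum ν) (sym ν≡))
                (trans (cong (_∸ vsum ν) (vsum-snoc ν (Vec.last μ))) (ℕP.m+n∸m≡n (vsum ν) (Vec.last μ)))

coeff-schur-leading : ∀ {n} (μ : Vec ℕ n) → Decreasing μ → Σ ℕ λ k → coeff (schur n μ) μ ≡ + suc k
coeff-schur-leading μ μ-dec = coeff-occurs (schur _ μ) μ (schur-unit μ-dec) (schur-leading _ μ μ-dec)

ᵇ⇒decreasing : ∀ {n} (v : Vec ℕ n) → T (isDecreasingB v) → Decreasing v
ᵇ⇒decreasing []          _ = tt
ᵇ⇒decreasing (a ∷ [])    _ = tt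
ᵇ⇒decreasing (a ∷ b ∷ v) t =
  ℕP.≤ᵇ⇒≤ b a (proj₁ (Equivalence.to T-∧ t))
  , ᵇ⇒decreasing (b ∷ v) (proj₂ (Equivalence.to T-∧ t))

partition⇒ᵇ : ∀ {n} (v : Vec ℕ n) → IsPartition v → T (isDecreasingB v)
partition⇒ᵇ []          _      = tt
partition⇒ᵇ (a ∷ [])    _      = tt
partition⇒ᵇ (a ∷ b ∷ v) isPart = Equivalence.from T-∧
  ( ℕP.≤⇒≤ᵇ (isPart zero (suc zero) z≤n)
  , partition⇒ᵇ (b ∷ v) λ i j i≤j → isPart (suc i) (suc j) (s≤s i≤j))

entry≤vsum : ∀ {n} (v : Vec ℕ n) j → lookup v j ≤ vsum v
entry≤vsum (x ∷ v) zero    = ℕP.m≤m+n x (vsum v)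
entry≤vsum (x ∷ v) (suc j) = ℕP.≤-trans (entry≤vsum v j) (ℕP.m≤n+m (vsum v) x)

allVecs-complete : ∀ {n} b (v : Vec ℕ n) → (∀ j → lookup v j ≤ b) → v ∈ allVecs n b
allVecs-complete b []      _     = here refl
allVecs-complete b (x ∷ v) bound = ∈-concatMap⁺ (λ a → map (a ∷_) (allVecs _ b))
  (lose (∈-upTo⁺ (s≤s (bound zero))) (∈-map⁺ (x ∷_) (allVecs-complete b v (bound ∘ suc))))

isPartitionOf? : ∀ {n} N (v : Vec ℕ n) → Dec (T (does (vsum v ℕ.≟ N) ∧ isDecreasingB v))
isPartitionOf? N v = T? (does (vsum v ℕ.≟ N) ∧ isDecreasingB v)

∈-partitionsOf : ∀ {n N} (v : Vec ℕ n) → IsPartition v → vsum v ≡ N → v ∈ partitionsOf n N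
∈-partitionsOf {n} {N} v isPart |v| = ∈-filter⁺ (isPartitionOf? N)
  (allVecs-complete N v λ j → subst (lookup v j ≤_) |v| (entry≤vsum v j))
  (Equivalence.from T-∧ (ℕP.≡⇒≡ᵇ _ _ |v| , partition⇒ᵇ v isPart))

partitionsOf-decreasing : ∀ {n N} {v : Vec ℕ n} → v ∈ partitionsOf n N → Decreasing v
partitionsOf-decreasing {N = N} {v} v∈ =
  ᵇ⇒decreasing v (proj₂ (Equivalence.to T-∧ (proj₂ selected)))
  where
  selected : v ∈ allVecs _ N × T (does (vsum v ℕ.≟ N) ∧ isDecreasingB v)
  selected = ∈-filter⁻ (isPartitionOf? N) v∈

-- Triangularity of Schur expansions

schurCombination : ∀ {n} → List (Vec ℕ n) → (Vec ℕ n → ℤ) → Poly n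
schurCombination {n} L c = psum (map (λ μ → pscale (c μ) (schur n μ)) L)

UpClosed : ∀ {n} → (Vec ℕ n → Set) → Set
UpClosed U = ∀ {e ν} → e ⊴ ν → U e → U ν

schur-triangular : ∀ {n} (L : List (Vec ℕ n)) → (∀ {ν} → ν ∈ L → Decreasing ν) →
  (c : Vec ℕ n → ℤ) (f : Poly n) → PolyEq f (schurCombination L c) →
  {U : Vec ℕ n → Set} → Decidable U → UpClosed U → Supp (λ e → ¬ U e) f →
  ∀ {λ₀} → λ₀ ∈ L → U λ₀ → c λ₀ ≡ + 0
schur-triangular {n} L L-dec c f f≈ {U} U? U-up f-avoids {λ₀} λ₀∈L Uλ₀ with c λ₀ ℤ.≟ + 0
... | yes cλ₀≡0 = cλ₀≡0
... | no  cλ₀≢0 =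
  ⊥-elim (coeff-μ≢0 (trans (sym (f≈ μ)) (coeff-outside f f-avoids (λ ¬Uμ → ¬Uμ Uμ))))
  where
  Live : Vec ℕ n → Set
  Live ν = c ν ≢ + 0 × U ν

  live? : Decidable Live
  live? ν = ¬? (c ν ℤ.≟ + 0) ×-dec U? ν

  μ : Vec ℕ n
  μ = argmax potential λ₀ (filter live? L)

  μ-live : μ ∈ L × Live μ
  μ-live = argmax-all potential {P = λ ν → ν ∈ L × Live ν}
             (λ₀∈L , cλ₀≢0 , Uλ₀) (All.tabulate (∈-filter⁻ live?))

  μ-max : ∀ {ν} → ν ∈ L → Live ν → potential ν ≤ potential μ
  μ-max ν∈L live = All.lookup (f[xs]≤f[argmax] {f = potential} λ₀ (filter live? L))
                              (∈-filter⁺ live? ν∈L live)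

  Uμ : U μ
  Uμ = proj₂ (proj₂ μ-live)

  X : ℤ
  X = c μ ℤ.* coeff (schur n μ) μ

  -- The coefficient of x^μ in c_ν s_ν is 0 unless ν = μ: a nonzero one
  -- forces μ ⊴ ν, so ν is live and maximality gives ν = μ.
  term : ∀ {ν} → ν ∈ L → c ν ℤ.* coeff (schur n ν) μ ≡ + 0 ⊎ c ν ℤ.* coeff (schur n ν) μ ≡ X
  term {ν} ν∈L with c ν ℤ.≟ + 0 | coeff (schur n ν) μ ℤ.≟ + 0
  ... | yes cν≡0 | _        = inj₁ (trans (cong (ℤ._* coeff (schur n ν) μ) cν≡0)
                                           (ℤP.*-zeroˡ (coeff (schur n ν) μ)))
  ... | no  _    | yes K≡0  = inj₁ (trans (cong (c ν ℤ.*_) K≡0) (ℤP.*-zeroʳ (c ν)))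
  ... | no  cν≢0 | no  K≢0  = inj₂ (cong (λ w → c w ℤ.* coeff (schur n w) μ) (sym μ≡ν))
    where
    μ⊴ν : μ ⊴ ν
    μ⊴ν = coeff-inside (schur n ν) (schur-dominated (L-dec ν∈L)) K≢0
    μ≡ν : μ ≡ ν
    μ≡ν = ⊴-antisym μ⊴ν (μ-max ν∈L (cν≢0 , U-up μ⊴ν Uμ))

  g : Vec ℕ n → Poly n
  g ν = pscale (c ν) (schur n ν)

  scaled : ∀ ν → coeff (g ν) μ ≡ c ν ℤ.* coeff (schur n ν) μ
  scaled ν = coeff-scale (c ν) (schur n ν) μ

  -- So x^μ has coefficient (k+1)·c_μ·K_μμ ≠ 0 in Σ c_ν s_ν.

  coeff-μ≢0 : coeff (schurCombination L c) μ ≢ + 0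
  coeff-μ≢0 with coeff-sum-uniform⁺ g μ X L
                   (λ {ν} ν∈L → Sum.map (trans (scaled ν)) (trans (scaled ν)) (term ν∈L))
                   (proj₁ μ-live) (scaled μ)
                 | coeff-schur-leading μ (L-dec (proj₁ μ-live))
  ... | k , eq | k′ , Kμ = subst (_≢ + 0) (sym eq)
        (*-≢0 {+ suc k} (λ ()) (*-≢0 {c μ} (proj₁ (proj₂ μ-live)) Kμ≢0))
    where
    Kμ≢0 : coeff (schur n μ) μ ≢ + 0
    Kμ≢0 Kμ≡0 with trans (sym Kμ) Kμ≡0
    ... | ()

-- The Vandermonde bound

Bounded : ∀ {n} → ℕ → ℕ → Poly n → Set
Bounded m B p = Supp (λ e → pre m e ≤ B) p

pre-zipWith : ∀ {n} m (a b : Vec ℕ n) → pre m (zipWith _+_ a b) ≡ pre m a + pre m b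
pre-zipWith zero    a       b       = refl
pre-zipWith (suc m) []      []      = refl
pre-zipWith (suc m) (x ∷ a) (y ∷ b) =
  trans (cong (_+_ (x + y)) (pre-zipWith m a b)) (interchange x y (pre m a) (pre m b))

pre-replicate0 : ∀ n m → pre m (replicate n 0) ≡ 0
pre-replicate0 n       zero    = refl
pre-replicate0 zero    (suc m) = refl
pre-replicate0 (suc n) (suc m) = pre-replicate0 n m

-- Exponents add under multiplication, so the bounds add.
pmul-bounded : ∀ {n} m {a b} (p q : Poly n) → Bounded m a p → Bounded m b q →
               Bounded m (a + b) (pmul p q)
pmul-bounded m []      q []          _   = []
pmul-bounded m {a} {b} (s ∷ p) q (s≤a ∷ p≤a) q≤b = AllP.++⁺
  (AllP.map⁺ (All.map (λ {t} t≤b → subst (_≤ a + b) (sym (pre-zipWith m (proj₂ s) (proj₂ t)))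
                                          (ℕP.+-mono-≤ s≤a t≤b)) q≤b))
  (pmul-bounded m p q p≤a q≤b)

maxPre : ∀ {n} → ℕ → Poly n → ℕ
maxPre m = List.foldr (λ t acc → pre m (proj₂ t) ⊔ acc) 0

maxPre-bounded : ∀ {n} m (p : Poly n) → Bounded m (maxPre m p) p
maxPre-bounded m []      = []
maxPre-bounded m (t ∷ p) = ℕP.m≤m⊔n _ _
  ∷ All.map (λ le → ℕP.≤-trans le (ℕP.m≤n⊔m (pre m (proj₂ t)) _)) (maxPre-bounded m p)

pprod-bounded : ∀ {n} m (F : List (Poly n)) → Bounded m (sum (map (maxPre m) F)) (pprod F)
pprod-bounded {n} m []      = ℕP.≤-reflexive (pre-replicate0 n m) ∷ []
pprod-bounded     m (f ∷ F) = pmul-bounded m f (pprod F) (maxPre-bounded m f) (pprod-bounded m F)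

sum-concatMap-tabulate : ∀ {A B : Set} n (g : Fin n → A) (G : A → List B) (w : B → ℕ) (h : ℕ → ℕ) →
  (∀ i → sum (map w (G (g i))) ≤ h (toℕ i)) → sum (map w (concatMap G (tabulate g))) ≤ sumBelow n h
sum-concatMap-tabulate zero    g G w h _     = z≤n
sum-concatMap-tabulate (suc n) g G w h bound = ℕP.≤-trans
  (ℕP.≤-reflexive (trans (cong sum (map-++ w (G (g zero)) _)) (sum-++ (map w (G (g zero))) _)))
  (ℕP.+-mono-≤ (bound zero) (sum-concatMap-tabulate n (g ∘ suc) G w (h ∘ suc) (bound ∘ suc)))

-- crossWeight m a b = 1 if a < m and a < b, else 0: it bounds the
-- contribution of the factor x_a - x_b to the first m exponents.
crossWeight : ℕ → ℕ → ℕ → ℕ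
crossWeight zero    _       _       = 0
crossWeight (suc m) zero    zero    = 0
crossWeight (suc m) zero    (suc b) = 1
crossWeight (suc m) (suc a) zero    = 0
crossWeight (suc m) (suc a) (suc b) = crossWeight m a b

crossCount : ℕ → ℕ → ℕ
crossCount n m = sumBelow n (λ a → sumBelow n (crossWeight m a))

unitVec : ∀ {n} → Fin n → Vec ℕ n
unitVec {n} i = updateAt (replicate n 0) i (λ _ → 1)

pre-unitVec : ∀ {n} m (i : Fin n) → pre m (unitVec i) ≤ 1
pre-unitVec           zero    i       = z≤n
pre-unitVec {suc n}   (suc m) zero    = ℕP.≤-reflexive (cong suc (pre-replicate0 n m))
pre-unitVec {suc n}   (suc m) (suc i) = pre-unitVec m i

factor : ∀ {n} → Fin n → Fin n → Poly n
factor i j = padd (var i) (pscale (ℤ.- (+ 1)) (var j))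

factor-weight : ∀ {n} m (i j : Fin n) → toℕ i < toℕ j →
                maxPre m (factor i j) ≤ crossWeight m (toℕ i) (toℕ j)
factor-weight zero i j _ = z≤n
factor-weight {suc n} (suc m) zero    zero    ()
factor-weight {suc n} (suc m) zero    (suc j) _ =
  ℕP.⊔-lub (ℕP.≤-reflexive (cong suc (pre-replicate0 n m))) (ℕP.⊔-lub (pre-unitVec (suc m) (suc j)) z≤n)
factor-weight {suc n} (suc m) (suc i) zero    ()
factor-weight {suc n} (suc m) (suc i) (suc j) (s≤s i<j) = factor-weight m i j i<j

factor-if-weight : ∀ {n} m (i j : Fin n) →
  sum (map (maxPre m) (if does (toℕ i ℕ.<? toℕ j) then factor i j ∷ [] else []))
  ≤ crossWeight m (toℕ i) (toℕ j)
factor-if-weight m i j with toℕ i ℕ.<ᵇ toℕ j | ℕP.<ᵇ-reflects-< (toℕ i) (toℕ j)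
... | true  | ofʸ i<j = subst (_≤ crossWeight m (toℕ i) (toℕ j))
                                (sym (ℕP.+-identityʳ (maxPre m (factor i j)))) (factor-weight m i j i<j)
... | false | ofⁿ _   = z≤n

vandermonde-bounded : ∀ n m → Bounded m (crossCount n m) (vandermonde n)
vandermonde-bounded n m =
  All.map (λ le → ℕP.≤-trans le total) (pprod-bounded m (concatMap row (allFin n)))
  where
  row : Fin n → List (Poly n)
  row i = concatMap (λ j → if does (toℕ i ℕ.<? toℕ j) then factor i j ∷ [] else []) (allFin n)
  total : sum (map (maxPre m) (concatMap row (allFin n))) ≤ crossCount n m
  total = sum-concatMap-tabulate n id row (maxPre m) (λ a → sumBelow n (crossWeight m a)) λ i →
            sum-concatMap-tabulate n id _ (maxPre m) (crossWeight m (toℕ i)) (factor-if-weight m i)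

-- Counting the pairs

sumBelow-zero : ∀ k {f : ℕ → ℕ} → (∀ p → f p ≡ 0) → sumBelow k f ≡ 0
sumBelow-zero zero    _  = refl
sumBelow-zero (suc k) f0 = cong₂ _+_ (f0 0) (sumBelow-zero k (f0 ∘ suc))

sumBelow-one : ∀ k → sumBelow k (λ _ → 1) ≡ k
sumBelow-one zero    = refl
sumBelow-one (suc k) = cong suc (sumBelow-one k)

crossCount-zero : ∀ n → crossCount n 0 ≡ 0
crossCount-zero n = sumBelow-zero n (λ _ → sumBelow-zero n (λ _ → refl))

-- Peeling off the first variable: it pairs with the n later ones.
crossCount-suc : ∀ n m → crossCount (suc n) (suc m) ≡ n + crossCount n m
crossCount-suc n m = cong (_+ crossCount n m) (sumBelow-one n)

crossCount-identity : ∀ m k → crossCount (m + k) m + crossCount (m + k) m + k * (k ∸ 1)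
                              ≡ (m + k) * (m + k ∸ 1)
crossCount-identity zero    k = cong (λ x → x + x + k * (k ∸ 1)) (crossCount-zero k)
crossCount-identity (suc m) k = begin
  C′ + C′ + K                 ≡⟨ cong (λ x → x + x + K) (crossCount-suc t m) ⟩
  (t + C) + (t + C) + K       ≡⟨ regroup t C K ⟩
  t + t + (C + C + K)         ≡⟨ cong (_+_ (t + t)) (crossCount-identity m k) ⟩
  t + t + t * (t ∸ 1)         ≡⟨ triangle t ⟩
  suc t * t                   ∎
  where
  open ≡-Reasoning
  open +-*-Solver
  t = m + k
  C = crossCount t m
  C′ = crossCount (suc t) (suc m)
  K = k * (k ∸ 1)
  regroup : ∀ a b c → (a + b) + (a + b) + c ≡ a + a + (b + b + c)
  regroup = solve 3 (λ a b c → (a :+ b) :+ (a :+ b) :+ c := a :+ a :+ (b :+ b :+ c)) refl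
  triangle : ∀ a → a + a + a * (a ∸ 1) ≡ suc a * a
  triangle zero    = refl
  triangle (suc a) = solve 1 (λ a → (con 1 :+ a) :+ (con 1 :+ a) :+ (con 1 :+ a) :* a
                                    := (con 2 :+ a) :* (con 1 :+ a)) refl a

crossCount-complement : ∀ {n i} → i < n →
  crossCount n (n ∸ suc i) + crossCount n (n ∸ suc i) + suc i * i ≡ n * (n ∸ 1)
crossCount-complement {n} {i} i<n =
  subst (λ N → crossCount N (n ∸ suc i) + crossCount N (n ∸ suc i) + suc i * i ≡ N * (N ∸ 1))
        (ℕP.m∸n+n≡m i<n) (crossCount-identity (n ∸ suc i) (suc i))

prefix+suffix : ∀ {n} m (v : Vec ℕ n) s → (∀ j → m ≤ toℕ j → lookup v j ≡ s) →
                pre m v + (n ∸ m) * s ≡ vsum v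
prefix+suffix zero    []      s _    = refl
prefix+suffix zero    (x ∷ v) s same =
  trans (cong (_+ _) (sym (same zero z≤n)))
        (cong (_+_ x) (prefix+suffix zero v s (λ j _ → same (suc j) z≤n)))
prefix+suffix (suc m) []      s _    = refl
prefix+suffix (suc m) (x ∷ v) s same =
  trans (ℕP.+-assoc x (pre m v) _)
        (cong (_+_ x) (prefix+suffix m v s (λ j m≤j → same (suc j) (s≤s m≤j))))

complement-< : ∀ {B P N k i s} → B + suc k * i ≡ N → P + suc k * s ≡ N → s < i → B < P
complement-< {B} {P} {k = k} {i} {s} eqB eqP s<i = ℕP.+-cancelʳ-< (suc k * i) B P
  (subst (_< P + suc k * i) (trans eqP (sym eqB)) (ℕP.+-monoʳ-< P (ℕP.*-monoʳ-< (suc k) s<i)))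

mainTheorem5 : (n : ℕ) → 1 ≤ n → (λ′ : Vec ℕ n) → IsPartition λ′
    → vsum λ′ ≡ n * (n ∸ 1) → n ∸ 1 ≤ len λ′ → len λ′ ≤ n
    → SchurCoeffNonzero n (n * (n ∸ 1)) (pmul (vandermonde n) (vandermonde n)) λ′
    → (i s : ℕ) → i < n
    → ((j : Fin n) → n ∸ suc i ≤ toℕ j → lookup λ′ j ≡ s)
    → i ≤ s
mainTheorem5 n _ λ′ isPart |λ′| _ _ (c , expansion , cλ≢0) i s i<n bottom with i ℕ.≤? s
... | yes i≤s = i≤s
... | no  i≰s = ⊥-elim (cλ≢0 (schur-triangular (partitionsOf n N) (partitionsOf-decreasing {n} {N})
                  c (pmul V V) expansion beyond? beyond-upClosed V²-avoids
                  (∈-partitionsOf λ′ isPart |λ′|) λ-beyond))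
  where
  N : ℕ
  N = n * (n ∸ 1)
  V : Poly n
  V = vandermonde n
  m : ℕ
  m = n ∸ suc i
  B : ℕ
  B = crossCount n m + crossCount n m
  beyond? : Decidable (λ e → B < pre m e)
  beyond? e = B ℕ.<? pre m e
  beyond-upClosed : UpClosed (λ e → B < pre m e)
  beyond-upClosed e⊴ν B<e = ℕP.<-≤-trans B<e (e⊴ν m)
  V²-avoids : Supp (λ e → ¬ B < pre m e) (pmul V V)
  V²-avoids = All.map ℕP.≤⇒≯ (pmul-bounded m V V (vandermonde-bounded n m) (vandermonde-bounded n m))
  bottom-sum : pre m λ′ + suc i * s ≡ N
  bottom-sum = trans (cong (λ k → pre m λ′ + k * s) (sym (ℕP.m∸[m∸n]≡n i<n)))
                     (trans (prefix+suffix m λ′ s bottom) |λ′|)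
  λ-beyond : B < pre m λ′
  λ-beyond = complement-< {k = i} (crossCount-complement i<n) bottom-sum (ℕP.≰⇒> i≰s)
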